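{- The system $\mathsf{NL}+\{\mathrm{D}\}$, obtained by adding the axiom scheme (D) $\varphi\Rightarrow\varphi\oplus\psi$ to $\mathsf{NL}$, is trivial: every formula is a theorem of it.
   Context: Formulas: built from countably many variables with binary $\otimes,\circ$ and unary ${}^{*}$. Abbreviations: $\varphi\Rightarrow\psi:=(\varphi\circ\psi^{*})^{*}$; $\varphi\Leftrightarrow\psi:=(\varphi\Rightarrow\psi)\otimes(\psi\Rightarrow\varphi)$; $\varphi\not\Leftrightarrow\psi:=(\varphi\Leftrightarrow\psi)^{*}$; $\varphi\not\Leftrightarrow\psi\not\Leftrightarrow\chi:=((\varphi\not\Leftrightarrow\psi)\otimes(\varphi\not\Leftrightarrow\chi))\otimes(\psi\not\Leftrightarrow\chi)$; $\varphi\oplus\psi:=(\varphi^{*}\otimes\psi^{*})^{*}$. The theorems of $\mathsf{NL}$ are generated from all instances of (A1) $\varphi\Rightarrow\varphi$; (A2) $(\varphi\circ\psi)\Rightarrow(\psi\circ\varphi)$; (A3) $\varphi\Rightarrow\varphi^{**}$; (A4) $(\varphi\Rightarrow\psi)\Rightarrow(\varphi\circ\psi)$; (A5) $(\varphi\otimes\psi)\Leftrightarrow(\psi\otimes\varphi)$; (A6) $((\varphi\otimes\psi)\Rightarrow\chi)\Rightarrow((\varphi\otimes\chi^{*})\Rightarrow\psi^{*})$; (A7) $(\varphi\not\Leftrightarrow\psi\not\Leftrightarrow\chi)\Rightarrow((\varphi\Rightarrow\psi)\Rightarrow((\psi\Rightarrow\chi)\Rightarrow(\varphi\Rightarrow\chi)))$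 by the rules, applied to theorems only: from $\vdash\varphi\Rightarrow\psi$ and $\vdash\varphi$ infer $\vdash\psi$; from $\vdash\varphi$ and $\vdash\psi$ infer $\vdash\varphi\otimes\psi$; from $\vdash\varphi\Leftrightarrow\psi$ and $\vdash\chi$ infer $\vdash\chi'$ ($\chi'$ obtained from $\chi$ by replacing one or more occurrences of $\varphi$ by $\psi$); from $\vdash\varphi\otimes\psi$ infer $\vdash\varphi$. -}

module Defs where

open import Data.Nat using (ℕ)

data Fm : Set where
  var  : ℕ → Fm
  _⊗_  : Fm → Fm → Fm
  _∘_  : Fm → Fm → Fm
  _*   : Fm → Fm

infixl 30 _*
infixr 20 _⊗_ _∘_
infixr 10 _⇒_ _⇔_ _⇎_ _⊕_

_⇒_ : Fm → Fm → Fm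
φ ⇒ ψ = (φ ∘ (ψ *)) *

_⇔_ : Fm → Fm → Fm
φ ⇔ ψ = (φ ⇒ ψ) ⊗ (ψ ⇒ φ)

_⇎_ : Fm → Fm → Fm
φ ⇎ ψ = (φ ⇔ ψ) *

⇎3 : Fm → Fm → Fm → Fm
⇎3 φ ψ χ = ((φ ⇎ ψ) ⊗ (φ ⇎ χ)) ⊗ (ψ ⇎ χ)

_⊕_ : Fm → Fm → Fm
φ ⊕ ψ = ((φ *) ⊗ (ψ *)) *

-- Replacement: Repl φ ψ χ χ' means χ' is obtained from χ by replacing
-- one or more occurrences of φ by ψ.  Repl? allows zero or more.
mutual
  data Repl (φ ψ : Fm) : Fm → Fm → Set where
    here  : Repl φ ψ φ ψ
    ⊗l    : ∀ {a a' b b'} → Repl φ ψ a a' → Repl? φ ψ b b' → Repl φ ψ (a ⊗ b) (a' ⊗ b')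
    ⊗r    : ∀ {a b b'} → Repl φ ψ b b' → Repl φ ψ (a ⊗ b) (a ⊗ b')
    ∘l    : ∀ {a a' b b'} → Repl φ ψ a a' → Repl? φ ψ b b' → Repl φ ψ (a ∘ b) (a' ∘ b')
    ∘r    : ∀ {a b b'} → Repl φ ψ b b' → Repl φ ψ (a ∘ b) (a ∘ b')
    *c    : ∀ {a a'} → Repl φ ψ a a' → Repl φ ψ (a *) (a' *)

  data Repl? (φ ψ : Fm) : Fm → Fm → Set where
    same : ∀ {a} → Repl? φ ψ a a
    some : ∀ {a a'} → Repl φ ψ a a' → Repl? φ ψ a a'

data AxNL : Fm → Set where
  A1 : ∀ φ → AxNL (φ ⇒ φ)
  A2 : ∀ φ ψ → AxNL ((φ ∘ ψ) ⇒ (ψ ∘ φ))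
  A3 : ∀ φ → AxNL (φ ⇒ φ * *)
  A4 : ∀ φ ψ → AxNL ((φ ⇒ ψ) ⇒ (φ ∘ ψ))
  A5 : ∀ φ ψ → AxNL ((φ ⊗ ψ) ⇔ (ψ ⊗ φ))
  A6 : ∀ φ ψ χ → AxNL (((φ ⊗ ψ) ⇒ χ) ⇒ ((φ ⊗ (χ *)) ⇒ (ψ *)))
  A7 : ∀ φ ψ χ → AxNL (⇎3 φ ψ χ ⇒ ((φ ⇒ ψ) ⇒ ((ψ ⇒ χ) ⇒ (φ ⇒ χ))))

data AxD : Fm → Set where
  D : ∀ φ ψ → AxD (φ ⇒ (φ ⊕ ψ))

data Thm (Ax : Fm → Set) : Fm → Set where
  nl   : ∀ {φ} → AxNL φ → Thm Ax φ
  extra : ∀ {φ} → Ax φ → Thm Ax φ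
  mp   : ∀ {φ ψ} → Thm Ax (φ ⇒ ψ) → Thm Ax φ → Thm Ax ψ
  adj  : ∀ {φ ψ} → Thm Ax φ → Thm Ax ψ → Thm Ax (φ ⊗ ψ)
  repl : ∀ {φ ψ χ χ'} → Thm Ax (φ ⇔ ψ) → Thm Ax χ → Repl φ ψ χ χ' → Thm Ax χ'
  simp : ∀ {φ ψ} → Thm Ax (φ ⊗ ψ) → Thm Ax φ

Thm-NLD : Fm → Set
Thm-NLD = Thm AxD

{-# OPTIONS --safe #-}
-- (D) at φ * and ψ * is, up to commutativity of ∘ and double negation, the
-- theorem (φ ⊗ ψ) ⇒ φ, so ⊗ can be eliminated on both sides.  For
-- θ = (t ⊗ t *) ∘ t * this makes both θ and θ * theorems: θ * is literally
-- (t ⊗ t *) ⇒ t, and A4 turns (t ⊗ t *) ⇒ t * into θ.  A theorem whose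
-- negation is also a theorem explodes: (D) gives (θ * ⊗ ψ *) *, and A6
-- cancels θ * from it, leaving ψ * *.
module Submission where

open import Defs

module _ {Ax : Fm → Set} where

  ∘-comm : ∀ φ ψ → Thm Ax ((φ ∘ ψ) ⇔ (ψ ∘ φ))
  ∘-comm φ ψ = adj (nl (A2 φ ψ)) (nl (A2 ψ φ))

  **-elim : ∀ φ → Thm Ax (φ * * ⇒ φ)
  **-elim φ = repl (∘-comm (φ *) (φ * *)) (nl (A1 (φ *))) (*c here)

  **-⇔ : ∀ φ → Thm Ax (φ * * ⇔ φ)
  **-⇔ φ = adj (**-elim φ) (nl (A3 φ))

  ⊗-comm-⇒ : ∀ {φ ψ χ} → Thm Ax ((φ ⊗ ψ) ⇒ χ) → Thm Ax ((ψ ⊗ φ) ⇒ χ)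
  ⊗-comm-⇒ {φ} {ψ} φ⊗ψ⇒χ = repl (nl (A5 φ ψ)) φ⊗ψ⇒χ (*c (∘l here same))

  ⊗*-syllogism : ∀ {φ ψ} → Thm Ax φ → Thm Ax ((φ ⊗ ψ) *) → Thm Ax (ψ *)
  ⊗*-syllogism {φ} {ψ} ⊢φ ⊢¬φ⊗ψ =
    mp (mp (nl (A6 φ ψ (φ ⊗ ψ))) (nl (A1 (φ ⊗ ψ)))) (adj ⊢φ ⊢¬φ⊗ψ)

⊗-elimˡ : ∀ φ ψ → Thm-NLD ((φ ⊗ ψ) ⇒ φ)
⊗-elimˡ φ ψ = repl (**-⇔ ψ) without-φ** (*c (∘l (⊗r here) same))
  where
  commuted : Thm-NLD (((φ * * ⊗ ψ * *) * * ∘ φ *) *)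
  commuted = repl (∘-comm (φ *) ((φ * * ⊗ ψ * *) * *)) (extra (D (φ *) (ψ *))) (*c here)
  without-outer** : Thm-NLD (((φ * * ⊗ ψ * *) ∘ φ *) *)
  without-outer** = repl (**-⇔ (φ * * ⊗ ψ * *)) commuted (*c (∘l here same))
  without-φ** : Thm-NLD (((φ ⊗ ψ * *) ∘ φ *) *)
  without-φ** = repl (**-⇔ φ) without-outer** (*c (∘l (⊗l here same) same))

⊗-elimʳ : ∀ φ ψ → Thm-NLD ((φ ⊗ ψ) ⇒ ψ)
⊗-elimʳ φ ψ = ⊗-comm-⇒ (⊗-elimˡ ψ φ)

explosion : ∀ {θ} ψ → Thm-NLD θ → Thm-NLD (θ *) → Thm-NLD ψ
explosion {θ} ψ ⊢θ ⊢¬θ = mp (**-elim ψ) (⊗*-syllogism ⊢¬θ (mp (extra (D θ ψ)) ⊢θ))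

contradiction : ∀ φ → Thm-NLD ((φ ⊗ φ *) ∘ φ *)
contradiction φ = mp (nl (A4 (φ ⊗ φ *) (φ *))) (⊗-elimʳ φ (φ *))

proposition5p10 : (φ : Fm) → Thm-NLD φ
proposition5p10 φ = explosion φ (contradiction t) (⊗-elimˡ t (t *))
  where
  t = var 0
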